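{- For all integers $k\ge 0$ and $n\ge k+2$, $$\sum_{l=0}^{k+1}\left\{{n+1\atop n-l+1}\right\}_{n-k}\widehat c_{n-l}^{(-k)}=0.$$
   Context: For an integer $k$, the poly-Cauchy numbers of the second kind $\widehat c_n^{(k)}$ are defined by $\mathrm{Lif}_k(-\log(1+x))=\sum_{n\ge0}\widehat c_n^{(k)}x^n/n!$, where $\mathrm{Lif}_k(z)=\sum_{m\ge0}\frac{z^m}{m!(m+1)^k}$; thus $\widehat c_n^{(-k)}$ uses $\mathrm{Lif}_{ -k}(z)=\sum_{m\ge0}\frac{(m+1)^k z^m}{m!}$. For $r\ge 0$, the $r$-Stirling number of the second kind $\left\{{n\atop m}\right\}_r$ is the number of ways to partition $\{1,\dots,n\}$ into $m$ nonempty disjoint blocks such that $1,\dots,r$ lie in distinct blocks; equivalently $\left\{{n\atop m}\right\}_r=0$ for $n<r$, $\left\{{r\atop m}\right\}_r=\delta_{m,r}$, and $\left\{{n\atop m}\right\}_r=m\left\{{n-1\atop m}\right\}_r+\left\{{n-1\atop m-1}\right\}_r$ for $n>r$. -}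

module Defs where

open import Data.Nat as ℕ using (ℕ; zero; suc; _!; _<ᵇ_; _≡ᵇ_; _∸_)
open import Data.Nat.Properties using (_!≢0)
open import Data.Integer as ℤ using (ℤ; +_)
open import Data.Rational as ℚ using (ℚ; _/_; 0ℚ; 1ℚ; _+_; _*_; -_)
open import Data.Bool using (Bool; true; false; if_then_else_)

ℕ→ℚ : ℕ → ℚ
ℕ→ℚ n = + n / 1

Σ≤ : ℕ → (ℕ → ℚ) → ℚ
Σ≤ zero    f = f 0
Σ≤ (suc n) f = Σ≤ n f + f (suc n)

-- Formal power series over ℚ, represented by their coefficient sequences
Series : Set
Series = ℕ → ℚ

_⊛_ : Series → Series → Series
(f ⊛ g) n = Σ≤ n (λ i → f i * g (n ∸ i))

oneS : Series
oneS zero    = 1ℚ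
oneS (suc _) = 0ℚ

_^S_ : Series → ℕ → Series
f ^S zero  = oneS
f ^S suc m = f ⊛ (f ^S m)

negLog1p : Series
negLog1p zero    = 0ℚ
negLog1p (suc i) = sgn (suc i) * ((+ 1) / suc i)
  where
  sgn : ℕ → ℚ
  sgn zero    = 1ℚ
  sgn (suc j) = - sgn j

-- Coefficients of Lif_{-k}(z) = Σ_{m≥0} (m+1)^k z^m / m!
lifNegCoeff : ℕ → ℕ → ℚ
lifNegCoeff k m = (+ (suc m ℕ.^ k) / (m !)) {{m !≢0}}

-- Poly-Cauchy numbers of the second kind with negative index:
--   Lif_{-k}(-log(1+x)) = Σ_n ĉ_n^{(-k)} x^n / n!.
-- Since (-log(1+x))^m has no terms of degree < m, the coefficient of x^n
-- only receives contributions from m = 0, …, n, so the sum is exact.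
polyCauchy2Neg : (k n : ℕ) → ℚ
polyCauchy2Neg k n =
  ℕ→ℚ (n !) * Σ≤ n (λ m → lifNegCoeff k m * (negLog1p ^S m) n)

rStirling2 : (r n m : ℕ) → ℕ
rStirling2 r zero m = if r ≡ᵇ 0 then (if m ≡ᵇ 0 then 1 else 0) else 0
rStirling2 r (suc n) m =
  if suc n <ᵇ r then 0
  else if suc n ≡ᵇ r then (if m ≡ᵇ r then 1 else 0)
  else (m ℕ.* rStirling2 r n m ℕ.+ prev m)
  where
  prev : ℕ → ℕ
  prev zero    = 0
  prev (suc j) = rStirling2 r n j

{-# OPTIONS --safe #-}
-- Write Σ_m w_m (-log(1+x))^m = Σ_n A(w)_n x^n / n!, so that ĉ_n^{(-k)} = A(w)_n for
-- w_m = (m+1)^k / m!. Since (1+x) d/dx (-log(1+x))^m = -m (-log(1+x))^(m-1), the map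
-- a ↦ ((n+1) a_n + a_(n+1))_n sends A(w) to A(w′) with w′_m = w_m - (m+1) w_(m+1), and on
-- w_m = q_m / m! this is the difference q_m - q_(m+1). By the recurrence of the r-Stirling
-- numbers, the sum in the theorem is that map applied k+1 times to ĉ^{(-k)}, evaluated at
-- n-k-1; it vanishes because k+1 differences kill the polynomial (m+1)^k of degree k.
module Submission where

open import Defs
open import Data.Nat as ℕ using (ℕ; zero; suc; _≤_; _<_; _∸_; _!; z≤n; s≤s)
open import Data.Nat.Properties as ℕP using (_!≢0)
open import Data.Integer as ℤ using (+_)
import Data.Integer.Properties as ℤP
open import Data.Rational as ℚ using (ℚ; 0ℚ; 1ℚ; _+_; _*_; -_; _/_)
import Data.Rational.Properties as ℚP
open import Data.Rational.Unnormalised using (mkℚᵘ; *≡*; _≃_)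
import Data.Rational.Unnormalised.Properties as ℚᵘP
open import Data.Rational.Solver renaming (module +-*-Solver to ℚ-Solver)
open import Relation.Binary.PropositionalEquality
open import Data.Bool using (true; false)
open import Data.Bool.Properties using (¬-not; T-≡)
open import Function.Bundles using (module Equivalence)
open import Function.Endo.Propositional Series using (_^_)

open ℚ-Solver using (solve; _:+_; _:*_; :-_; _:=_; con)

toℚᵘ-/ : ∀ a d → ℚ.toℚᵘ (+ a / suc d) ≃ mkℚᵘ (+ a) d
toℚᵘ-/ a d = ℚP.toℚᵘ-fromℚᵘ (mkℚᵘ (+ a) d)

≡-viaℚᵘ : ∀ {p q} i j d e → ℚ.toℚᵘ p ≃ mkℚᵘ i d → ℚ.toℚᵘ q ≃ mkℚᵘ j e →
          i ℤ.* + suc e ≡ j ℤ.* + suc d → p ≡ q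
≡-viaℚᵘ i j d e p≃ q≃ eq = ℚP.toℚᵘ-injective (ℚᵘP.≃-trans p≃ (ℚᵘP.≃-trans (*≡* eq) (ℚᵘP.≃-sym q≃)))

ℕ→ℚ-homo-+ : ∀ a b → ℕ→ℚ (a ℕ.+ b) ≡ ℕ→ℚ a + ℕ→ℚ b
ℕ→ℚ-homo-+ a b = ≡-viaℚᵘ _ _ 0 0 (toℚᵘ-/ (a ℕ.+ b) 0)
  (ℚᵘP.≃-trans (ℚP.toℚᵘ-homo-+ (ℕ→ℚ a) (ℕ→ℚ b)) (ℚᵘP.+-cong (toℚᵘ-/ a 0) (toℚᵘ-/ b 0)))
  (cong (ℤ._* + 1) (trans (ℤP.pos-+ a b) (sym (cong₂ ℤ._+_ (ℤP.*-identityʳ (+ a)) (ℤP.*-identityʳ (+ b))))))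

ℕ→ℚ-homo-* : ∀ a b → ℕ→ℚ (a ℕ.* b) ≡ ℕ→ℚ a * ℕ→ℚ b
ℕ→ℚ-homo-* a b = ≡-viaℚᵘ _ _ 0 0 (toℚᵘ-/ (a ℕ.* b) 0)
  (ℚᵘP.≃-trans (ℚP.toℚᵘ-homo-* (ℕ→ℚ a) (ℕ→ℚ b)) (ℚᵘP.*-cong (toℚᵘ-/ a 0) (toℚᵘ-/ b 0)))
  (cong (ℤ._* + 1) (ℤP.pos-* a b))

/-as-* : ∀ a d .{{_ : ℕ.NonZero d}} → + a / d ≡ ℕ→ℚ a * (+ 1 / d)
/-as-* a (suc d) = ≡-viaℚᵘ _ _ d _ (toℚᵘ-/ a d)
  (ℚᵘP.≃-trans (ℚP.toℚᵘ-homo-* (ℕ→ℚ a) (+ 1 / suc d)) (ℚᵘP.*-cong (toℚᵘ-/ a 0) (toℚᵘ-/ 1 d)))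
  (trans (cong (λ x → + a ℤ.* + suc x) (ℕP.+-identityʳ d)) (cong (ℤ._* + suc d) (sym (ℤP.*-identityʳ (+ a)))))

ℕ→ℚ-*-1/[*] : ∀ m d .{{_ : ℕ.NonZero d}} → ℕ→ℚ (suc m) * ((+ 1 / (suc m ℕ.* d)) {{ℕP.m*n≢0 (suc m) d}}) ≡ + 1 / d
ℕ→ℚ-*-1/[*] m (suc d) = ≡-viaℚᵘ _ _ _ d
  (ℚᵘP.≃-trans (ℚP.toℚᵘ-homo-* (ℕ→ℚ (suc m)) _) (ℚᵘP.*-cong (toℚᵘ-/ (suc m) 0) (toℚᵘ-/ 1 (d ℕ.+ m ℕ.* suc d))))
  (toℚᵘ-/ 1 d)
  (trans (cong (ℤ._* + suc d) (ℤP.*-identityʳ (+ suc m)))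
         (trans (sym (ℤP.pos-* (suc m) (suc d))) (sym (trans (ℤP.*-identityˡ _) (cong (λ x → + suc x) (ℕP.+-identityʳ _))))))

ℕ→ℚ-*-1/ : ∀ i → ℕ→ℚ (suc i) * (+ 1 / suc i) ≡ 1ℚ
ℕ→ℚ-*-1/ i = ≡-viaℚᵘ _ (+ 1) _ 0
  (ℚᵘP.≃-trans (ℚP.toℚᵘ-homo-* (ℕ→ℚ (suc i)) _) (ℚᵘP.*-cong (toℚᵘ-/ (suc i) 0) (toℚᵘ-/ 1 i)))
  ℚᵘP.≃-refl
  (trans (ℤP.*-identityʳ _) (trans (ℤP.*-identityʳ _)
         (sym (trans (ℤP.*-identityˡ _) (cong (λ x → + suc x) (ℕP.+-identityʳ i))))))

Σ≤-cong : ∀ n {f g : ℕ → ℚ} → (∀ i → i ≤ n → f i ≡ g i) → Σ≤ n f ≡ Σ≤ n g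
Σ≤-cong zero    f≗g = f≗g 0 z≤n
Σ≤-cong (suc n) f≗g = cong₂ _+_ (Σ≤-cong n (λ i i≤n → f≗g i (ℕP.m≤n⇒m≤1+n i≤n))) (f≗g (suc n) ℕP.≤-refl)

Σ≤-distrib-+ : ∀ n f g → Σ≤ n (λ i → f i + g i) ≡ Σ≤ n f + Σ≤ n g
Σ≤-distrib-+ zero    f g = refl
Σ≤-distrib-+ (suc n) f g = trans (cong (_+ (f (suc n) + g (suc n))) (Σ≤-distrib-+ n f g))
  (solve 4 (λ a b c d → (a :+ b) :+ (c :+ d) := (a :+ c) :+ (b :+ d)) refl (Σ≤ n f) (Σ≤ n g) (f (suc n)) (g (suc n)))

Σ≤-*ˡ : ∀ n c f → c * Σ≤ n f ≡ Σ≤ n (λ i → c * f i)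
Σ≤-*ˡ zero    c f = refl
Σ≤-*ˡ (suc n) c f = trans (ℚP.*-distribˡ-+ c (Σ≤ n f) (f (suc n))) (cong (_+ c * f (suc n)) (Σ≤-*ˡ n c f))

Σ≤-neg : ∀ n f → - Σ≤ n f ≡ Σ≤ n (λ i → - f i)
Σ≤-neg zero    f = refl
Σ≤-neg (suc n) f = trans (ℚP.neg-distrib-+ (Σ≤ n f) (f (suc n))) (cong (_+ - f (suc n)) (Σ≤-neg n f))

Σ≤-zero : ∀ n f → (∀ i → i ≤ n → f i ≡ 0ℚ) → Σ≤ n f ≡ 0ℚ
Σ≤-zero zero    f f≗0 = f≗0 0 z≤n
Σ≤-zero (suc n) f f≗0 = trans (cong₂ _+_ (Σ≤-zero n f (λ i i≤n → f≗0 i (ℕP.m≤n⇒m≤1+n i≤n))) (f≗0 (suc n) ℕP.≤-refl)) (ℚP.+-identityʳ 0ℚ)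

Σ≤-sucˡ : ∀ n f → Σ≤ (suc n) f ≡ f 0 + Σ≤ n (λ i → f (suc i))
Σ≤-sucˡ zero    f = refl
Σ≤-sucˡ (suc n) f = trans (cong (_+ f (suc (suc n))) (Σ≤-sucˡ n f)) (ℚP.+-assoc (f 0) _ _)

Σ≤-reverse : ∀ n f → Σ≤ n f ≡ Σ≤ n (λ i → f (n ∸ i))
Σ≤-reverse zero    f = refl
Σ≤-reverse (suc n) f = sym (begin
    Σ≤ (suc n) (λ i → f (suc n ∸ i))
  ≡⟨ Σ≤-sucˡ n (λ i → f (suc n ∸ i)) ⟩
    f (suc n) + Σ≤ n (λ i → f (n ∸ i))
  ≡⟨ cong (_+_ (f (suc n))) (sym (Σ≤-reverse n f)) ⟩
    f (suc n) + Σ≤ n f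
  ≡⟨ ℚP.+-comm (f (suc n)) (Σ≤ n f) ⟩
    Σ≤ (suc n) f ∎)
  where open ≡-Reasoning

Σ≤-*-split : ∀ n F → ℕ→ℚ n * Σ≤ n F ≡ Σ≤ n (λ i → ℕ→ℚ i * F i) + Σ≤ n (λ i → ℕ→ℚ (n ∸ i) * F i)
Σ≤-*-split n F = trans (Σ≤-*ˡ n (ℕ→ℚ n) F) (trans (Σ≤-cong n split) (Σ≤-distrib-+ n _ _))
  where
  split : ∀ i → i ≤ n → ℕ→ℚ n * F i ≡ ℕ→ℚ i * F i + ℕ→ℚ (n ∸ i) * F i
  split i i≤n = begin
      ℕ→ℚ n * F i                          ≡⟨ cong (λ m → ℕ→ℚ m * F i) (sym (ℕP.m+[n∸m]≡n i≤n)) ⟩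
      ℕ→ℚ (i ℕ.+ (n ∸ i)) * F i            ≡⟨ cong (_* F i) (ℕ→ℚ-homo-+ i (n ∸ i)) ⟩
      (ℕ→ℚ i + ℕ→ℚ (n ∸ i)) * F i          ≡⟨ ℚP.*-distribʳ-+ (F i) (ℕ→ℚ i) (ℕ→ℚ (n ∸ i)) ⟩
      ℕ→ℚ i * F i + ℕ→ℚ (n ∸ i) * F i      ∎
    where open ≡-Reasoning

-- δ f is the coefficient sequence of (1 + x) f′.
δ : Series → Series
δ h n = ℕ→ℚ (suc n) * h (suc n) + ℕ→ℚ n * h n

δ-⊛ : ∀ f g n → δ (f ⊛ g) n ≡ (δ f ⊛ g) n + (f ⊛ δ g) n
δ-⊛ f g n = begin
    ℕ→ℚ (suc n) * Σ≤ (suc n) H + ℕ→ℚ n * Σ≤ n K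
  ≡⟨ cong₂ _+_ split-H (Σ≤-*-split n K) ⟩
    (A + C) + (B + D)
  ≡⟨ solve 4 (λ a b c d → (a :+ c) :+ (b :+ d) := (a :+ b) :+ (c :+ d)) refl A B C D ⟩
    (A + B) + (C + D)
  ≡⟨ sym (cong₂ _+_ (trans (Σ≤-cong n (λ i _ → δf-term i)) (Σ≤-distrib-+ n _ _))
                     (trans (Σ≤-cong n δg-term) (Σ≤-distrib-+ n _ _))) ⟩
    (δ f ⊛ g) n + (f ⊛ δ g) n
  ∎
  where
  open ≡-Reasoning
  H K : ℕ → ℚ
  H i = f i * g (suc n ∸ i)
  K i = f i * g (n ∸ i)
  A B C D : ℚ
  A = Σ≤ n (λ i → ℕ→ℚ (suc i) * H (suc i))
  B = Σ≤ n (λ i → ℕ→ℚ i * K i)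
  C = Σ≤ n (λ i → ℕ→ℚ (suc n ∸ i) * H i)
  D = Σ≤ n (λ i → ℕ→ℚ (n ∸ i) * K i)
  split-H : ℕ→ℚ (suc n) * Σ≤ (suc n) H ≡ A + C
  split-H = trans (Σ≤-*-split (suc n) H) (cong₂ _+_
    (trans (Σ≤-sucˡ n (λ i → ℕ→ℚ i * H i)) (trans (cong (_+ A) (ℚP.*-zeroˡ (H 0))) (ℚP.+-identityˡ A)))
    (trans (cong (λ m → C + ℕ→ℚ m * H (suc n)) (ℕP.n∸n≡0 n)) (trans (cong (_+_ C) (ℚP.*-zeroˡ (H (suc n)))) (ℚP.+-identityʳ C))))
  δf-term : ∀ i → (ℕ→ℚ (suc i) * f (suc i) + ℕ→ℚ i * f i) * g (n ∸ i) ≡ ℕ→ℚ (suc i) * H (suc i) + ℕ→ℚ i * K i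
  δf-term i = solve 5 (λ a b c d e → (a :* b :+ c :* d) :* e := a :* (b :* e) :+ c :* (d :* e)) refl
                (ℕ→ℚ (suc i)) (f (suc i)) (ℕ→ℚ i) (f i) (g (n ∸ i))
  δg-term : ∀ i → i ≤ n → f i * δ g (n ∸ i) ≡ ℕ→ℚ (suc n ∸ i) * H i + ℕ→ℚ (n ∸ i) * K i
  δg-term i i≤n rewrite ℕP.+-∸-assoc 1 i≤n =
    solve 5 (λ a b c d e → a :* (b :* c :+ d :* e) := b :* (a :* c) :+ d :* (a :* e)) refl
      (f i) (ℕ→ℚ (suc (n ∸ i))) (g (suc (n ∸ i))) (ℕ→ℚ (n ∸ i)) (g (n ∸ i))

⊛-congʳ : ∀ f {g g′} → (∀ j → g j ≡ g′ j) → ∀ n → (f ⊛ g) n ≡ (f ⊛ g′) n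
⊛-congʳ f g≗g′ n = Σ≤-cong n (λ i _ → cong (f i *_) (g≗g′ (n ∸ i)))

⊛-congˡ : ∀ {f f′} g → (∀ j → f j ≡ f′ j) → ∀ n → (f ⊛ g) n ≡ (f′ ⊛ g) n
⊛-congˡ g f≗f′ n = Σ≤-cong n (λ i _ → cong (_* g (n ∸ i)) (f≗f′ i))

⊛-identityˡ : ∀ h n → (oneS ⊛ h) n ≡ h n
⊛-identityˡ h zero    = ℚP.*-identityˡ (h 0)
⊛-identityˡ h (suc n) = begin
    (oneS ⊛ h) (suc n)
  ≡⟨ Σ≤-sucˡ n (λ i → oneS i * h (suc n ∸ i)) ⟩
    1ℚ * h (suc n) + Σ≤ n (λ i → 0ℚ * h (n ∸ i))
  ≡⟨ cong₂ _+_ (ℚP.*-identityˡ (h (suc n))) (Σ≤-zero n _ (λ i _ → ℚP.*-zeroˡ (h (n ∸ i)))) ⟩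
    h (suc n) + 0ℚ
  ≡⟨ ℚP.+-identityʳ (h (suc n)) ⟩
    h (suc n) ∎
  where open ≡-Reasoning

⊛-zeroʳ : ∀ f n → (f ⊛ (λ _ → 0ℚ)) n ≡ 0ℚ
⊛-zeroʳ f n = Σ≤-zero n _ (λ i _ → ℚP.*-zeroʳ (f i))

⊛-negˡ : ∀ f g n → ((λ j → - f j) ⊛ g) n ≡ - (f ⊛ g) n
⊛-negˡ f g n = trans (Σ≤-cong n (λ i _ → sym (ℚP.neg-distribˡ-* (f i) (g (n ∸ i))))) (sym (Σ≤-neg n _))

⊛-negScaleʳ : ∀ f g c n → (f ⊛ (λ j → - (c * g j))) n ≡ - (c * (f ⊛ g) n)
⊛-negScaleʳ f g c n = begin
    Σ≤ n (λ i → f i * - (c * g (n ∸ i)))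
  ≡⟨ Σ≤-cong n (λ i _ → solve 3 (λ a b x → a :* (:- (b :* x)) := :- (b :* (a :* x))) refl (f i) c (g (n ∸ i))) ⟩
    Σ≤ n (λ i → - (c * (f i * g (n ∸ i))))
  ≡⟨ sym (Σ≤-neg n _) ⟩
    - Σ≤ n (λ i → c * (f i * g (n ∸ i)))
  ≡⟨ cong -_ (sym (Σ≤-*ˡ n c _)) ⟩
    - (c * (f ⊛ g) n) ∎
  where open ≡-Reasoning

δ-oneS : ∀ n → δ oneS n ≡ 0ℚ
δ-oneS zero    = refl
δ-oneS (suc n) = cong₂ _+_ (ℚP.*-zeroʳ (ℕ→ℚ (suc (suc n)))) (ℚP.*-zeroʳ (ℕ→ℚ (suc n)))

altSign : ℕ → ℚ
altSign zero    = 1ℚ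
altSign (suc j) = - altSign j

altSign-unique : (s : ℕ → ℚ) → s 0 ≡ 1ℚ → (∀ j → s (suc j) ≡ - s j) → ∀ j → s j ≡ altSign j
altSign-unique s s0 s-suc zero    = s0
altSign-unique s s0 s-suc (suc j) = trans (s-suc j) (cong -_ (altSign-unique s s0 s-suc j))

-- Defs computes the sign of negLog1p (suc i) by a where-bound function of i, whose
-- instances for different i are not definitionally equal. The with-abstractions expose
-- that function applied to a fresh variable, so that altSign-unique can identify it.
negLog1p-suc : ∀ i → negLog1p (suc i) ≡ altSign (suc i) * (+ 1 / suc i)
negLog1p-suc zero    = refl
negLog1p-suc (suc w) with + 1 / suc (suc w)
... | y with suc w
... | v with -_ | altSign-unique _ refl (λ _ → refl) | w
... | neg | agrees | x = cong (λ s → neg (neg s) * y) (agrees x)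

ℕ→ℚ-*-negLog1p : ∀ i → ℕ→ℚ (suc i) * negLog1p (suc i) ≡ altSign (suc i)
ℕ→ℚ-*-negLog1p i = begin
    ℕ→ℚ (suc i) * negLog1p (suc i)                    ≡⟨ cong (ℕ→ℚ (suc i) *_) (negLog1p-suc i) ⟩
    ℕ→ℚ (suc i) * (altSign (suc i) * (+ 1 / suc i))   ≡⟨ solve 3 (λ a s x → a :* (s :* x) := s :* (a :* x)) refl (ℕ→ℚ (suc i)) (altSign (suc i)) (+ 1 / suc i) ⟩
    altSign (suc i) * (ℕ→ℚ (suc i) * (+ 1 / suc i))   ≡⟨ cong (altSign (suc i) *_) (ℕ→ℚ-*-1/ i) ⟩
    altSign (suc i) * 1ℚ                              ≡⟨ ℚP.*-identityʳ (altSign (suc i)) ⟩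
    altSign (suc i)                                   ∎
  where open ≡-Reasoning

δ-negLog1p : ∀ n → δ negLog1p n ≡ - oneS n
δ-negLog1p zero    = refl
δ-negLog1p (suc n) = trans (cong₂ _+_ (ℕ→ℚ-*-negLog1p (suc n)) (ℕ→ℚ-*-negLog1p n)) (ℚP.+-inverseˡ (altSign (suc n)))

δ-negLog1p^S : ∀ m n → δ (negLog1p ^S suc m) n ≡ - (ℕ→ℚ (suc m) * (negLog1p ^S m) n)
δ-negLog1p^S m n = begin
    δ (negLog1p ⊛ (negLog1p ^S m)) n
  ≡⟨ δ-⊛ negLog1p (negLog1p ^S m) n ⟩
    (δ negLog1p ⊛ (negLog1p ^S m)) n + (negLog1p ⊛ δ (negLog1p ^S m)) n
  ≡⟨ cong₂ _+_ differentiated-factor (differentiated-power m) ⟩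
    - (negLog1p ^S m) n + - (ℕ→ℚ m * (negLog1p ^S m) n)
  ≡⟨ solve 2 (λ a x → :- x :+ :- (a :* x) := :- ((con 1ℚ :+ a) :* x)) refl (ℕ→ℚ m) ((negLog1p ^S m) n) ⟩
    - ((1ℚ + ℕ→ℚ m) * (negLog1p ^S m) n)
  ≡⟨ cong (λ a → - (a * (negLog1p ^S m) n)) (sym (ℕ→ℚ-homo-+ 1 m)) ⟩
    - (ℕ→ℚ (suc m) * (negLog1p ^S m) n) ∎
  where
  open ≡-Reasoning
  differentiated-factor : (δ negLog1p ⊛ (negLog1p ^S m)) n ≡ - (negLog1p ^S m) n
  differentiated-factor = trans (⊛-congˡ (negLog1p ^S m) δ-negLog1p n)
    (trans (⊛-negˡ oneS (negLog1p ^S m) n) (cong -_ (⊛-identityˡ (negLog1p ^S m) n)))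
  differentiated-power : ∀ m → (negLog1p ⊛ δ (negLog1p ^S m)) n ≡ - (ℕ→ℚ m * (negLog1p ^S m) n)
  differentiated-power zero     = trans (⊛-congʳ negLog1p δ-oneS n)
    (trans (⊛-zeroʳ negLog1p n) (sym (cong -_ (ℚP.*-zeroˡ (oneS n)))))
  differentiated-power (suc m′) = trans (⊛-congʳ negLog1p (δ-negLog1p^S m′) n)
    (⊛-negScaleʳ negLog1p (negLog1p ^S m′) (ℕ→ℚ (suc m′)) n)

negLog1p^S-vanishes : ∀ m n → n ≤ m → (negLog1p ^S suc m) n ≡ 0ℚ
negLog1p^S-vanishes zero    zero    _   = refl
negLog1p^S-vanishes (suc m) n       n≤m = Σ≤-zero n _ term
  where
  term : ∀ i → i ≤ n → negLog1p i * (negLog1p ^S suc m) (n ∸ i) ≡ 0ℚ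
  term zero    _ = ℚP.*-zeroˡ ((negLog1p ^S suc m) n)
  term (suc i) _ = trans (cong (negLog1p (suc i) *_) (negLog1p^S-vanishes m (n ∸ suc i) (lower n n≤m)))
                         (ℚP.*-zeroʳ (negLog1p (suc i)))
    where
    lower : ∀ n → n ≤ suc m → n ∸ suc i ≤ m
    lower zero    _         = z≤n
    lower (suc n) (s≤s n≤m) = ℕP.≤-trans (ℕP.m∸n≤m n i) n≤m

PointwiseCongruent : (Series → Series) → Set
PointwiseCongruent F = ∀ {a b} → (∀ n → a n ≡ b n) → ∀ n → F a n ≡ F b n

^-cong : ∀ {F} → PointwiseCongruent F → ∀ j → PointwiseCongruent (F ^ j)
^-cong F-cong zero    a≗b = a≗b
^-cong F-cong (suc j) a≗b = F-cong (^-cong F-cong j a≗b)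

^-sucʳ : ∀ F j a → (F ^ suc j) a ≡ (F ^ j) (F a)
^-sucʳ F zero    a = refl
^-sucʳ F (suc j) a = cong F (^-sucʳ F j a)

^-intertwine : ∀ {F G} (T : Series → Series) → PointwiseCongruent F →
               (∀ w n → F (T w) n ≡ T (G w) n) → ∀ j w n → (F ^ j) (T w) n ≡ T ((G ^ j) w) n
^-intertwine T F-cong FT≗TG zero    w n = refl
^-intertwine {G = G} T F-cong FT≗TG (suc j) w n =
  trans (F-cong (^-intertwine T F-cong FT≗TG j w) n) (FT≗TG ((G ^ j) w) n)

-- cauchyCoeff w n is the coefficient of x^n in Σ_m w m (-log(1+x))^m, whose terms with m > n
-- vanish by negLog1p^S-vanishes; polyCauchy2Neg k is cauchyTransform (lifNegCoeff k) by definition.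
cauchyCoeff : (ℕ → ℚ) → Series
cauchyCoeff w n = Σ≤ n (λ m → w m * (negLog1p ^S m) n)

cauchyTransform : (ℕ → ℚ) → ℕ → ℚ
cauchyTransform w n = ℕ→ℚ (n !) * cauchyCoeff w n

expDiff : (ℕ → ℚ) → ℕ → ℚ
expDiff w m = w m + - (ℕ→ℚ (suc m) * w (suc m))

cauchyCoeff-step : ∀ w n → ℕ→ℚ (suc n) * (cauchyCoeff w n + cauchyCoeff w (suc n)) ≡ cauchyCoeff (expDiff w) n
cauchyCoeff-step w n = begin
    ℕ→ℚ (suc n) * (cauchyCoeff w n + Σ≤ (suc n) (λ m → w m * P m (suc n)))
  ≡⟨ cong (λ x → ℕ→ℚ (suc n) * (x + cauchyCoeff w (suc n))) (sym extended) ⟩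
    ℕ→ℚ (suc n) * (Σ≤ (suc n) (λ m → w m * P m n) + Σ≤ (suc n) (λ m → w m * P m (suc n)))
  ≡⟨ cong (ℕ→ℚ (suc n) *_) (sym (Σ≤-distrib-+ (suc n) _ _)) ⟩
    ℕ→ℚ (suc n) * Σ≤ (suc n) (λ m → w m * P m n + w m * P m (suc n))
  ≡⟨ trans (Σ≤-*ˡ (suc n) (ℕ→ℚ (suc n)) _) (Σ≤-cong (suc n) (λ m _ → to-δ m)) ⟩
    Σ≤ (suc n) (λ m → w m * P m n + w m * δ (P m) n)
  ≡⟨ Σ≤-distrib-+ (suc n) _ _ ⟩
    Σ≤ (suc n) (λ m → w m * P m n) + Σ≤ (suc n) (λ m → w m * δ (P m) n)
  ≡⟨ cong₂ _+_ extended differentiated ⟩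
    cauchyCoeff w n + Σ≤ n (λ m → - (ℕ→ℚ (suc m) * w (suc m)) * P m n)
  ≡⟨ sym (trans (Σ≤-cong n (λ m _ → ℚP.*-distribʳ-+ (P m n) (w m) _)) (Σ≤-distrib-+ n _ _)) ⟩
    cauchyCoeff (expDiff w) n ∎
  where
  open ≡-Reasoning
  P : ℕ → Series
  P m = negLog1p ^S m
  extended : Σ≤ (suc n) (λ m → w m * P m n) ≡ cauchyCoeff w n
  extended = trans (cong (λ x → cauchyCoeff w n + w (suc n) * x) (negLog1p^S-vanishes n n ℕP.≤-refl))
                   (trans (cong (_+_ (cauchyCoeff w n)) (ℚP.*-zeroʳ (w (suc n)))) (ℚP.+-identityʳ _))
  to-δ : ∀ m → ℕ→ℚ (suc n) * (w m * P m n + w m * P m (suc n)) ≡ w m * P m n + w m * δ (P m) n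
  to-δ m = trans (cong (λ a → a * (w m * P m n + w m * P m (suc n))) (ℕ→ℚ-homo-+ 1 n))
    (trans (solve 4 (λ a y x₀ x₁ → (con 1ℚ :+ a) :* (y :* x₀ :+ y :* x₁) := y :* x₀ :+ y :* ((con 1ℚ :+ a) :* x₁ :+ a :* x₀))
                    refl (ℕ→ℚ n) (w m) (P m n) (P m (suc n)))
           (cong (λ a → w m * P m n + w m * (a * P m (suc n) + ℕ→ℚ n * P m n)) (sym (ℕ→ℚ-homo-+ 1 n))))
  differentiated : Σ≤ (suc n) (λ m → w m * δ (P m) n) ≡ Σ≤ n (λ m → - (ℕ→ℚ (suc m) * w (suc m)) * P m n)
  differentiated = trans (Σ≤-sucˡ n _) (trans (cong₂ _+_
      (trans (cong (w 0 *_) (δ-oneS n)) (ℚP.*-zeroʳ (w 0)))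
      (Σ≤-cong n (λ m _ → trans (cong (w (suc m) *_) (δ-negLog1p^S m n))
        (solve 3 (λ a b x → a :* (:- (b :* x)) := :- (b :* a) :* x) refl (w (suc m)) (ℕ→ℚ (suc m)) (P m n)))))
    (ℚP.+-identityˡ _))

stirlingStep : (ℕ → ℚ) → ℕ → ℚ
stirlingStep a n = ℕ→ℚ (suc n) * a n + a (suc n)

stirlingStep-cauchyTransform : ∀ w n → stirlingStep (cauchyTransform w) n ≡ cauchyTransform (expDiff w) n
stirlingStep-cauchyTransform w n = begin
    ℕ→ℚ (suc n) * (ℕ→ℚ (n !) * F) + ℕ→ℚ (suc n ℕ.* n !) * G
  ≡⟨ cong (λ x → ℕ→ℚ (suc n) * (ℕ→ℚ (n !) * F) + x * G) (ℕ→ℚ-homo-* (suc n) (n !)) ⟩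
    ℕ→ℚ (suc n) * (ℕ→ℚ (n !) * F) + ℕ→ℚ (suc n) * ℕ→ℚ (n !) * G
  ≡⟨ solve 4 (λ a b f g → a :* (b :* f) :+ a :* b :* g := b :* (a :* (f :+ g))) refl (ℕ→ℚ (suc n)) (ℕ→ℚ (n !)) F G ⟩
    ℕ→ℚ (n !) * (ℕ→ℚ (suc n) * (F + G))
  ≡⟨ cong (ℕ→ℚ (n !) *_) (cauchyCoeff-step w n) ⟩
    cauchyTransform (expDiff w) n ∎
  where
  open ≡-Reasoning
  F = cauchyCoeff w n
  G = cauchyCoeff w (suc n)

stirlingStep-cong : PointwiseCongruent stirlingStep
stirlingStep-cong a≗b n = cong₂ (λ x y → ℕ→ℚ (suc n) * x + y) (a≗b n) (a≗b (suc n))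

expDiff-cong : PointwiseCongruent expDiff
expDiff-cong v≗w m = cong₂ (λ x y → x + - (ℕ→ℚ (suc m) * y)) (v≗w m) (v≗w (suc m))

cauchyTransform-zero : ∀ w n → (∀ m → w m ≡ 0ℚ) → cauchyTransform w n ≡ 0ℚ
cauchyTransform-zero w n w≗0 = trans
  (cong (ℕ→ℚ (n !) *_) (Σ≤-zero n _ (λ m _ → trans (cong (_* (negLog1p ^S m) n) (w≗0 m)) (ℚP.*-zeroˡ ((negLog1p ^S m) n)))))
  (ℚP.*-zeroʳ (ℕ→ℚ (n !)))

Δ : (ℕ → ℚ) → ℕ → ℚ
Δ q m = q m + - q (suc m)

Δ-cong : PointwiseCongruent Δ
Δ-cong p≗q m = cong₂ (λ x y → x + - y) (p≗q m) (p≗q (suc m))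

Δ^-sub : ∀ j p q m → (Δ ^ j) (λ m → p m + - q m) m ≡ (Δ ^ j) p m + - (Δ ^ j) q m
Δ^-sub zero    p q m = refl
Δ^-sub (suc j) p q m = trans (Δ-cong (Δ^-sub j p q) m)
  (solve 4 (λ a b x y → (a :+ :- x) :+ :- (b :+ :- y) := (a :+ :- b) :+ :- (x :+ :- y)) refl
     ((Δ ^ j) p m) ((Δ ^ j) p (suc m)) ((Δ ^ j) q m) ((Δ ^ j) q (suc m)))

Δ^-shift : ∀ j q m → (Δ ^ j) (λ m → q (suc m)) m ≡ (Δ ^ j) q (suc m)
Δ^-shift j q m = ^-intertwine (λ q m → q (suc m)) Δ-cong (λ _ _ → refl) j q m

DegreeBelow : ℕ → (ℕ → ℚ) → Set
DegreeBelow d q = ∀ m → (Δ ^ d) q m ≡ 0ℚ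

degreeBelow-cong : ∀ d {p q} → (∀ m → p m ≡ q m) → DegreeBelow d p → DegreeBelow d q
degreeBelow-cong d p≗q p-deg m = trans (sym (^-cong Δ-cong d p≗q m)) (p-deg m)

indexScale : (ℕ → ℚ) → ℕ → ℚ
indexScale q m = ℕ→ℚ (suc m) * q m

Δ-indexScale : ∀ q m → Δ (indexScale q) m ≡ indexScale (Δ q) m + - q (suc m)
Δ-indexScale q m = trans (cong (λ a → ℕ→ℚ (suc m) * q m + - (a * q (suc m))) (ℕ→ℚ-homo-+ 1 (suc m)))
  (solve 3 (λ a x y → a :* x :+ :- ((con 1ℚ :+ a) :* y) := a :* (x :+ :- y) :+ :- y) refl (ℕ→ℚ (suc m)) (q m) (q (suc m)))

degreeBelow-indexScale : ∀ d q → DegreeBelow d q → DegreeBelow (suc d) (indexScale q)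
degreeBelow-indexScale d q q-deg m = begin
    (Δ ^ suc d) (indexScale q) m
  ≡⟨ cong (λ f → f m) (^-sucʳ Δ d (indexScale q)) ⟩
    (Δ ^ d) (Δ (indexScale q)) m
  ≡⟨ ^-cong Δ-cong d (Δ-indexScale q) m ⟩
    (Δ ^ d) (λ m → indexScale (Δ q) m + - q (suc m)) m
  ≡⟨ Δ^-sub d (indexScale (Δ q)) (λ m → q (suc m)) m ⟩
    (Δ ^ d) (indexScale (Δ q)) m + - (Δ ^ d) (λ m → q (suc m)) m
  ≡⟨ cong₂ (λ x y → x + - y) (scaled-difference d q q-deg m) (trans (Δ^-shift d q m) (q-deg (suc m))) ⟩
    0ℚ ∎
  where
  open ≡-Reasoning
  scaled-difference : ∀ d q → DegreeBelow d q → DegreeBelow d (indexScale (Δ q))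
  scaled-difference zero     q q≗0  m = trans (cong (ℕ→ℚ (suc m) *_) (Δ-cong q≗0 m)) (ℚP.*-zeroʳ (ℕ→ℚ (suc m)))
  scaled-difference (suc d′) q q-deg  = degreeBelow-indexScale d′ (Δ q) (λ m → trans (sym (cong (λ f → f m) (^-sucʳ Δ d′ q))) (q-deg m))

degreeBelow-power : ∀ k → DegreeBelow (suc k) (λ m → ℕ→ℚ (suc m ℕ.^ k))
degreeBelow-power zero    m = refl
degreeBelow-power (suc k) = degreeBelow-cong (suc (suc k)) (λ m → sym (ℕ→ℚ-homo-* (suc m) (suc m ℕ.^ k)))
  (degreeBelow-indexScale (suc k) _ (degreeBelow-power k))

invFact : ℕ → ℚ
invFact m = (+ 1 / m !) {{m !≢0}}

expDiff-invFact : ∀ q m → expDiff (λ m → q m * invFact m) m ≡ Δ q m * invFact m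
expDiff-invFact q m = begin
    q m * invFact m + - (ℕ→ℚ (suc m) * (q (suc m) * invFact (suc m)))
  ≡⟨ cong (λ x → q m * invFact m + - x) (solve 3 (λ a b c → a :* (b :* c) := b :* (a :* c)) refl (ℕ→ℚ (suc m)) (q (suc m)) (invFact (suc m))) ⟩
    q m * invFact m + - (q (suc m) * (ℕ→ℚ (suc m) * invFact (suc m)))
  ≡⟨ cong (λ x → q m * invFact m + - (q (suc m) * x)) (ℕ→ℚ-*-1/[*] m (m !) {{m !≢0}}) ⟩
    q m * invFact m + - (q (suc m) * invFact m)
  ≡⟨ solve 3 (λ a b x → a :* x :+ :- (b :* x) := (a :+ :- b) :* x) refl (q m) (q (suc m)) (invFact m) ⟩
    Δ q m * invFact m ∎
  where open ≡-Reasoning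

expDiff^-annihilates-lifNegCoeff : ∀ k m → (expDiff ^ suc k) (lifNegCoeff k) m ≡ 0ℚ
expDiff^-annihilates-lifNegCoeff k m = begin
    (expDiff ^ suc k) (lifNegCoeff k) m
  ≡⟨ ^-cong expDiff-cong (suc k) (λ m → /-as-* (suc m ℕ.^ k) (m !) {{m !≢0}}) m ⟩
    (expDiff ^ suc k) (λ m → ℕ→ℚ (suc m ℕ.^ k) * invFact m) m
  ≡⟨ ^-intertwine {G = Δ} (λ q m → q m * invFact m) expDiff-cong expDiff-invFact (suc k) _ m ⟩
    (Δ ^ suc k) (λ m → ℕ→ℚ (suc m ℕ.^ k)) m * invFact m
  ≡⟨ cong (_* invFact m) (degreeBelow-power k m) ⟩
    0ℚ * invFact m
  ≡⟨ ℚP.*-zeroˡ (invFact m) ⟩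
    0ℚ ∎
  where open ≡-Reasoning

stirlingStep^-annihilates-polyCauchy2Neg : ∀ k n → (stirlingStep ^ suc k) (polyCauchy2Neg k) n ≡ 0ℚ
stirlingStep^-annihilates-polyCauchy2Neg k n =
  trans (^-intertwine {G = expDiff} cauchyTransform stirlingStep-cong stirlingStep-cauchyTransform (suc k) (lifNegCoeff k) n)
        (cauchyTransform-zero _ n (expDiff^-annihilates-lifNegCoeff k))

<ᵇ-false : ∀ {m n} → n ≤ m → (m ℕ.<ᵇ n) ≡ false
<ᵇ-false {m} {n} n≤m = ¬-not (λ m<ᵇn → ℕP.≤⇒≯ n≤m (ℕP.<ᵇ⇒< m n (Equivalence.from T-≡ m<ᵇn)))

≡ᵇ-false : ∀ {m n} → m ≢ n → (m ℕ.≡ᵇ n) ≡ false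
≡ᵇ-false {m} {n} m≢n = ¬-not (λ m≡ᵇn → m≢n (ℕP.≡ᵇ⇒≡ m n (Equivalence.from T-≡ m≡ᵇn)))

≡ᵇ-refl : ∀ m → (m ℕ.≡ᵇ m) ≡ true
≡ᵇ-refl m = Equivalence.to T-≡ (ℕP.≡⇒≡ᵇ m m refl)

rStirling2-rec : ∀ r N m → r ≤ N → rStirling2 r (suc N) (suc m) ≡ suc m ℕ.* rStirling2 r N (suc m) ℕ.+ rStirling2 r N m
rStirling2-rec r N m r≤N
  rewrite <ᵇ-false (ℕP.m≤n⇒m≤1+n r≤N) | ≡ᵇ-false (ℕP.>⇒≢ (s≤s r≤N)) = refl

rStirling2-diag : ∀ r → rStirling2 r r r ≡ 1
rStirling2-diag zero    = refl
rStirling2-diag (suc r) rewrite <ᵇ-false (ℕP.≤-refl {suc r}) | ≡ᵇ-refl (suc r) = refl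

rStirling2-below : ∀ r N m → m < r → rStirling2 r N m ≡ 0
rStirling2-below (suc r) zero    m m<r = refl
rStirling2-below r       (suc N) m m<r with suc N ℕ.<ᵇ r | suc N ℕ.≡ᵇ r
... | true  | _     = refl
... | false | true  rewrite ≡ᵇ-false (ℕP.<⇒≢ m<r) = refl
... | false | false with m
...   | zero   = refl
...   | suc m′ rewrite rStirling2-below r N (suc m′) m<r | rStirling2-below r N m′ (ℕP.<-trans (ℕP.n<1+n m′) m<r)
               = trans (ℕP.+-identityʳ _) (ℕP.*-zeroʳ m′)

rStirling2-above : ∀ r N m → N < m → rStirling2 r N m ≡ 0
rStirling2-above zero    zero    (suc m) _   = refl
rStirling2-above (suc r) zero    (suc m) _   = refl
rStirling2-above r       (suc N) (suc m) N<m with suc N ℕ.<ᵇ r | suc N ℕ.≡ᵇ r in N+1≡ᵇr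
... | true  | _     = refl
... | false | true  rewrite ≡ᵇ-false (ℕP.>⇒≢ (subst (_< suc m) (ℕP.≡ᵇ⇒≡ (suc N) r (Equivalence.from T-≡ N+1≡ᵇr)) N<m)) = refl
... | false | false rewrite rStirling2-above r N (suc m) (ℕP.<-trans (ℕP.n<1+n N) N<m) | rStirling2-above r N m (ℕP.≤-pred N<m)
                    = trans (ℕP.+-identityʳ _) (ℕP.*-zeroʳ m)

stirlingRowSum : ℕ → ℕ → (ℕ → ℚ) → ℚ
stirlingRowSum r′ j a = Σ≤ j (λ i → ℕ→ℚ (rStirling2 (suc r′) (suc r′ ℕ.+ j) (suc r′ ℕ.+ i)) * a (r′ ℕ.+ i))

stirlingRowSum-suc : ∀ r′ j a → stirlingRowSum r′ (suc j) a ≡ stirlingRowSum r′ j (stirlingStep a)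
stirlingRowSum-suc r′ j a = begin
    stirlingRowSum r′ (suc j) a
  ≡⟨ trans (Σ≤-cong (suc j) (λ i _ → recurrence i)) (Σ≤-distrib-+ (suc j) _ _) ⟩
    Σ≤ (suc j) (λ i → ℕ→ℚ (S (suc (t i))) * (ℕ→ℚ (suc (t i)) * a (t i))) + Σ≤ (suc j) (λ i → ℕ→ℚ (S (t i)) * a (t i))
  ≡⟨ cong₂ _+_ drop-last drop-first ⟩
    Σ≤ j (λ i → ℕ→ℚ (S (suc (t i))) * (ℕ→ℚ (suc (t i)) * a (t i))) + Σ≤ j (λ i → ℕ→ℚ (S (suc (t i))) * a (suc (t i)))
  ≡⟨ sym (trans (Σ≤-cong j (λ i _ → ℚP.*-distribˡ-+ (ℕ→ℚ (S (suc (t i)))) _ _)) (Σ≤-distrib-+ j _ _)) ⟩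
    stirlingRowSum r′ j (stirlingStep a) ∎
  where
  open ≡-Reasoning
  t : ℕ → ℕ
  t i = r′ ℕ.+ i
  S : ℕ → ℕ
  S = rStirling2 (suc r′) (suc (t j))
  recurrence : ∀ i → ℕ→ℚ (rStirling2 (suc r′) (suc r′ ℕ.+ suc j) (suc (t i))) * a (t i)
                   ≡ ℕ→ℚ (S (suc (t i))) * (ℕ→ℚ (suc (t i)) * a (t i)) + ℕ→ℚ (S (t i)) * a (t i)
  recurrence i = begin
      ℕ→ℚ (rStirling2 (suc r′) (suc (r′ ℕ.+ suc j)) (suc (t i))) * a (t i)
    ≡⟨ cong (λ N → ℕ→ℚ (rStirling2 (suc r′) (suc N) (suc (t i))) * a (t i)) (ℕP.+-suc r′ j) ⟩
      ℕ→ℚ (rStirling2 (suc r′) (suc (suc (t j))) (suc (t i))) * a (t i)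
    ≡⟨ cong (λ s → ℕ→ℚ s * a (t i)) (rStirling2-rec (suc r′) (suc (t j)) (t i) (s≤s (ℕP.m≤m+n r′ j))) ⟩
      ℕ→ℚ (suc (t i) ℕ.* S (suc (t i)) ℕ.+ S (t i)) * a (t i)
    ≡⟨ cong (_* a (t i)) (trans (ℕ→ℚ-homo-+ (suc (t i) ℕ.* S (suc (t i))) (S (t i))) (cong (_+ ℕ→ℚ (S (t i))) (ℕ→ℚ-homo-* (suc (t i)) (S (suc (t i)))))) ⟩
      (ℕ→ℚ (suc (t i)) * ℕ→ℚ (S (suc (t i))) + ℕ→ℚ (S (t i))) * a (t i)
    ≡⟨ solve 4 (λ u s s′ x → (u :* s :+ s′) :* x := s :* (u :* x) :+ s′ :* x) refl
         (ℕ→ℚ (suc (t i))) (ℕ→ℚ (S (suc (t i)))) (ℕ→ℚ (S (t i))) (a (t i)) ⟩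
      ℕ→ℚ (S (suc (t i))) * (ℕ→ℚ (suc (t i)) * a (t i)) + ℕ→ℚ (S (t i)) * a (t i) ∎
  drop-last : Σ≤ (suc j) (λ i → ℕ→ℚ (S (suc (t i))) * (ℕ→ℚ (suc (t i)) * a (t i)))
            ≡ Σ≤ j (λ i → ℕ→ℚ (S (suc (t i))) * (ℕ→ℚ (suc (t i)) * a (t i)))
  drop-last = trans (cong (λ s → A + ℕ→ℚ s * lifted (suc j)) (rStirling2-above (suc r′) (suc (t j)) (suc (t (suc j)))
                      (s≤s (ℕP.≤-reflexive (sym (ℕP.+-suc r′ j))))))
              (trans (cong (_+_ A) (ℚP.*-zeroˡ (lifted (suc j)))) (ℚP.+-identityʳ A))
    where
    lifted : ℕ → ℚ
    lifted i = ℕ→ℚ (suc (t i)) * a (t i)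
    A = Σ≤ j (λ i → ℕ→ℚ (S (suc (t i))) * lifted i)
  drop-first : Σ≤ (suc j) (λ i → ℕ→ℚ (S (t i)) * a (t i)) ≡ Σ≤ j (λ i → ℕ→ℚ (S (suc (t i))) * a (suc (t i)))
  drop-first = begin
      Σ≤ (suc j) (λ i → ℕ→ℚ (S (t i)) * a (t i))
    ≡⟨ Σ≤-sucˡ j _ ⟩
      ℕ→ℚ (S (t 0)) * a (t 0) + Σ≤ j (λ i → ℕ→ℚ (S (t (suc i))) * a (t (suc i)))
    ≡⟨ cong₂ _+_ (cong (λ s → ℕ→ℚ s * a (t 0)) (rStirling2-below (suc r′) (suc (t j)) (t 0) (s≤s (ℕP.≤-reflexive (ℕP.+-identityʳ r′)))))
                 (Σ≤-cong j (λ i _ → cong (λ u → ℕ→ℚ (S u) * a u) (ℕP.+-suc r′ i))) ⟩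
      0ℚ * a (t 0) + Σ≤ j (λ i → ℕ→ℚ (S (suc (t i))) * a (suc (t i)))
    ≡⟨ trans (cong (_+ Σ≤ j (λ i → ℕ→ℚ (S (suc (t i))) * a (suc (t i)))) (ℚP.*-zeroˡ (a (t 0)))) (ℚP.+-identityˡ _) ⟩
      Σ≤ j (λ i → ℕ→ℚ (S (suc (t i))) * a (suc (t i))) ∎

stirlingRowSum-stirlingStep^ : ∀ r′ j a → stirlingRowSum r′ j a ≡ (stirlingStep ^ j) a r′
stirlingRowSum-stirlingStep^ r′ zero a
  rewrite ℕP.+-identityʳ r′ | rStirling2-diag (suc r′) = ℚP.*-identityˡ (a r′)
stirlingRowSum-stirlingStep^ r′ (suc j) a = begin
    stirlingRowSum r′ (suc j) a                   ≡⟨ stirlingRowSum-suc r′ j a ⟩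
    stirlingRowSum r′ j (stirlingStep a)          ≡⟨ stirlingRowSum-stirlingStep^ r′ j (stirlingStep a) ⟩
    (stirlingStep ^ j) (stirlingStep a) r′        ≡⟨ cong (λ f → f r′) (sym (^-sucʳ stirlingStep j a)) ⟩
    (stirlingStep ^ suc j) a r′                   ∎
  where open ≡-Reasoning

+-∸-∸ : ∀ r {i K} → i ≤ K → r ℕ.+ K ∸ (K ∸ i) ≡ r ℕ.+ i
+-∸-∸ r {i} {K} i≤K = begin
    r ℕ.+ K ∸ (K ∸ i)                ≡⟨ cong (λ m → r ℕ.+ m ∸ (K ∸ i)) (sym (ℕP.m+[n∸m]≡n i≤K)) ⟩
    r ℕ.+ (i ℕ.+ (K ∸ i)) ∸ (K ∸ i)  ≡⟨ cong (_∸ (K ∸ i)) (sym (ℕP.+-assoc r i (K ∸ i))) ⟩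
    r ℕ.+ i ℕ.+ (K ∸ i) ∸ (K ∸ i)    ≡⟨ ℕP.m+n∸n≡m (r ℕ.+ i) (K ∸ i) ⟩
    r ℕ.+ i                          ∎
  where open ≡-Reasoning

theorem8 : (k n : ℕ) → k ℕ.+ 2 ≤ n →
    Σ≤ (k ℕ.+ 1)
      (λ l → ℕ→ℚ (rStirling2 (n ∸ k) (n ℕ.+ 1) (n ∸ l ℕ.+ 1))
               * polyCauchy2Neg k (n ∸ l))
      ≡ 0ℚ
theorem8 k n k+2≤n = begin
    Σ≤ K summand                                    ≡⟨ Σ≤-reverse K summand ⟩
    Σ≤ K (λ i → summand (K ∸ i))                    ≡⟨ Σ≤-cong K reindex ⟩
    stirlingRowSum r′ K (polyCauchy2Neg k)          ≡⟨ stirlingRowSum-stirlingStep^ r′ K (polyCauchy2Neg k) ⟩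
    (stirlingStep ^ K) (polyCauchy2Neg k) r′        ≡⟨ cong (λ j → (stirlingStep ^ j) (polyCauchy2Neg k) r′) (ℕP.+-comm k 1) ⟩
    (stirlingStep ^ suc k) (polyCauchy2Neg k) r′    ≡⟨ stirlingStep^-annihilates-polyCauchy2Neg k r′ ⟩
    0ℚ                                              ∎
  where
  open ≡-Reasoning
  K = k ℕ.+ 1
  r′ = n ∸ K
  summand : ℕ → ℚ
  summand l = ℕ→ℚ (rStirling2 (n ∸ k) (n ℕ.+ 1) (n ∸ l ℕ.+ 1)) * polyCauchy2Neg k (n ∸ l)
  n≡r′+K : n ≡ r′ ℕ.+ K
  n≡r′+K = sym (ℕP.m∸n+n≡m (ℕP.≤-trans (ℕP.+-monoʳ-≤ k (ℕP.n≤1+n 1)) k+2≤n))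
  n∸k≡1+r′ : n ∸ k ≡ suc r′
  n∸k≡1+r′ = trans (cong (_∸ k) (trans n≡r′+K (trans (cong (r′ ℕ.+_) (ℕP.+-comm k 1)) (ℕP.+-suc r′ k))))
                   (ℕP.m+n∸n≡m (suc r′) k)
  n∸[K∸i]≡r′+i : ∀ i → i ≤ K → n ∸ (K ∸ i) ≡ r′ ℕ.+ i
  n∸[K∸i]≡r′+i i i≤K = trans (cong (_∸ (K ∸ i)) n≡r′+K) (+-∸-∸ r′ i≤K)
  reindex : ∀ i → i ≤ K → summand (K ∸ i)
          ≡ ℕ→ℚ (rStirling2 (suc r′) (suc r′ ℕ.+ K) (suc r′ ℕ.+ i)) * polyCauchy2Neg k (r′ ℕ.+ i)
  reindex i i≤K rewrite n∸k≡1+r′ | cong (ℕ._+ 1) n≡r′+K | n∸[K∸i]≡r′+i i i≤K =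
    cong₂ (λ N m → ℕ→ℚ (rStirling2 (suc r′) N m) * polyCauchy2Neg k (r′ ℕ.+ i))
          (ℕP.+-comm (r′ ℕ.+ K) 1) (ℕP.+-comm (r′ ℕ.+ i) 1)
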